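{- Let $X$, $Y$ be finite nonempty sets, $F: X\to 2^Y$ a set-valued mapping, $(W_1,\ldots,W_m)$ a Hall partition of $F$, and $W\subset X$ a critical and non-reducible set of $F$. Then $W = W_i$ for some $1\le i\le m$.
   Context: A set-valued mapping $F: X \to 2^Y$ assigns to each $x$ a (possibly empty) subset $F(x) \subset Y$; $F(W) = \bigcup_{x\in W}F(x)$; $\sharp$ is cardinality. For $W \subset X$, $F_W: X\setminus W \to 2^Y$ is $F_W(x) = F(x) \setminus F(W)$ ($F_\emptyset=F$). For set-valued $G$ on a finite set, a subset $W$ of its domain is critical for $G$ if $W\ne\emptyset$ and $\sharp G(W)=\sharp W$; non-reducible for $G$ if $W\ne\emptyset$ and no proper subset of $W$ is critical for $G$. A tuple $(W_1,\ldots,W_m)$, $m\ge1$, is a Hall partition of $F$ if the $W_i$ are nonempty, pairwise disjoint with union $X$, and with $G_i = F_{W_1\cup\cdots\cup W_{i-1}}$ ($G_1=F$): (i) $G_i(x)\neq\emptyset$ for $x \in W_i$; (ii) $W_i$ is non-reducible for $G_i$; (iii) $W_i$ is critical for $G_i$ for $i \le m-1$. -}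

module Defs where

open import Data.Nat using (ℕ; zero; suc; _<_)
open import Data.Fin using (Fin; zero; suc; toℕ)
open import Data.Fin.Subset using (Subset; ⊥; _∪_; _─_; _⊂_; ∣_∣; Nonempty; _∩_; ⊤; _∈_)
open import Data.Vec using (_∷_; [])
open import Data.Bool using (true; false)
open import Data.Product using (_×_)
open import Relation.Nullary using (¬_)
open import Relation.Binary.PropositionalEquality using (_≡_)

-- X = Fin n, Y = Fin k. A set-valued mapping X → 2^Y.
-- A mapping defined only on a domain D ⊆ X is represented by a total
-- function Fin n → Subset k that is only ever evaluated on subsets of D.
SetMap : ℕ → ℕ → Set
SetMap n k = Fin n → Subset k

image : ∀ {n k} → SetMap n k → Subset n → Subset k
image {zero}  F []          = ⊥
image {suc n} F (true  ∷ W) = F zero ∪ image (λ x → F (suc x)) W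
image {suc n} F (false ∷ W) = image (λ x → F (suc x)) W

-- F_W(x) = F(x) \ F(W)   (intended domain X \ W)
restrictMap : ∀ {n k} → SetMap n k → Subset n → SetMap n k
restrictMap F W x = F x ─ image F W

Critical : ∀ {n k} → SetMap n k → Subset n → Set
Critical G W = Nonempty W × (∣ image G W ∣ ≡ ∣ W ∣)

NonReducible : ∀ {n k} → SetMap n k → Subset n → Set
NonReducible G W = Nonempty W × (∀ V → V ⊂ W → ¬ Critical G V)

-- union of the first c members of a family W : Fin m → Subset n
-- (unionBelow W c = W_1 ∪ ⋯ ∪ W_c in 1-based notation)
unionBelow : ∀ {m n} → (Fin m → Subset n) → ℕ → Subset n
unionBelow {zero}  W c       = ⊥
unionBelow {suc m} W zero    = ⊥
unionBelow {suc m} W (suc c) = W zero ∪ unionBelow (λ j → W (suc j)) c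

-- (W_1,…,W_m) indexed 0-based by Fin m; the paper's W_{i+1} is W i here,
-- and G_{i+1} = F_{W_1 ∪ ⋯ ∪ W_i} is hallG F W i.
hallG : ∀ {m n k} → SetMap n k → (Fin m → Subset n) → Fin m → SetMap n k
hallG F W i = restrictMap F (unionBelow W (toℕ i))

record HallPartition {n k : ℕ} (F : SetMap n k) (m : ℕ) (W : Fin m → Subset n) : Set where
  field
    m≥1         : 0 < m
    nonempty    : ∀ i → Nonempty (W i)
    disjoint    : ∀ i j → ¬ (i ≡ j) → W i ∩ W j ≡ ⊥
    covers      : unionBelow W m ≡ ⊤
    nonemptyVal : ∀ i x → x ∈ W i → Nonempty (hallG F W i x)
    nonReducible : ∀ i → NonReducible (hallG F W i) (W i)
    critical    : ∀ i → suc (toℕ i) < m → Critical (hallG F W i) (W i)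

-- Write U_c = W_1 ∪ ⋯ ∪ W_c, so that G_{c+1} = F_{U_c}. As W_i is non-reducible for G_i, whose values
-- on W_i are nonempty, removing one point at a time gives Hall's condition ♯A ≤ ♯G_i(A) for A ⊆ W_i,
-- strictly for nonempty proper A. A set V disjoint from U_c splits as (V ∩ W_{c+1}) ∪ (V ∖ W_{c+1}),
-- whose images under G_{c+1} and G_{c+2} are disjoint, so downward induction on c gives
-- ♯V ≤ ♯G_{c+1}(V). Now let W_i be the first part meeting W. If W ⊄ W_i, the same splitting gives
-- ♯W < ♯F(W ∩ W_i) + ♯G_{i+1}(W ∖ W_i) ≤ ♯F(W); if W ⊊ W_i, then ♯W < ♯G_i(W) ≤ ♯F(W). Both
-- contradict the criticality of W, so W = W_i.

module Submission where

open import Defs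
open import Data.Nat using (ℕ; _<_; zero; suc; _+_; _≤_; z≤n; s≤s)
open import Data.Nat.Induction using (<-wellFounded)
open import Data.Nat.Properties
  using (≤-trans; ≤-reflexive; <-≤-trans; ≤∧≢⇒<; <-irrefl; +-suc; +-mono-≤; +-monoˡ-≤; +-mono-<-≤;
         m≤n⇒m≤1+n; m≤n⇒m<n∨m≡n; module ≤-Reasoning)
open import Data.Fin using (Fin; zero; suc; toℕ)
open import Data.Fin.Properties using (toℕ-injective)
open import Data.Fin.Subset
  using (Subset; _∈_; _∉_; _⊆_; _⊂_; _∪_; _∩_; _─_; _-_; ⁅_⁆; ∣_∣; Nonempty; Empty; inside; outside)
open import Data.Fin.Subset.Properties
  using (drop-there; x∈p∪q⁺; x∈p∪q⁻; x∈p∩q⁺; p∩q⊆p; p∩q⊆q; ∣p∩q∣≤∣q∣; p─q⊆p; p⊆q⇒∣p∣≤∣q∣;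
         x∈p∧x∉q⇒x∈p─q; x∈p⇒p-x⊂p; x∈p⇒∣p-x∣<∣p∣; ⊂-⊆-trans; ⊆-antisym; Empty-unique;
         ∣⊥∣≡0; ∣⁅x⁆∣≡1; ∉⊥; ∈⊤; nonempty?; _∈?_)
open import Data.Vec using ([]; _∷_; here; there)
open import Data.Product using (∃; _,_; proj₁; proj₂; _×_)
import Data.Product as Product
open import Data.Sum using (inj₁; inj₂)
open import Data.Empty using (⊥-elim)
open import Function using (_∘_; id)
open import Induction.WellFounded using (Acc; acc)
open import Relation.Nullary using (¬_; yes; no)
open import Relation.Binary.PropositionalEquality using (_≡_; refl; sym; trans; cong; subst)

downwardInduction : ∀ {ℓ} m (Q : ℕ → Set ℓ) → Q m → (∀ (i : Fin m) → Q (suc (toℕ i)) → Q (toℕ i))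
                  → ∀ (j : Fin (suc m)) → Q (toℕ j)
downwardInduction zero    Q top step zero    = top
downwardInduction (suc m) Q top step zero    = step zero (downwardInduction m (Q ∘ suc) top (step ∘ suc) zero)
downwardInduction (suc m) Q top step (suc j) = downwardInduction m (Q ∘ suc) top (step ∘ suc) j

Disjoint : ∀ {n} → Subset n → Subset n → Set
Disjoint p q = ∀ {x} → x ∈ p → x ∉ q

x∈p─q⁻ : ∀ {n} (p q : Subset n) {x} → x ∈ p ─ q → x ∈ p × x ∉ q
x∈p─q⁻ (inside ∷ p)  (outside ∷ q) here       = here , λ ()
x∈p─q⁻ (outside ∷ p) (outside ∷ q) {zero} ()
x∈p─q⁻ (outside ∷ p) (inside ∷ q)  {zero} ()
x∈p─q⁻ (_ ∷ p)       (_ ∷ q)       (there x∈) = Product.map there (_∘ drop-there) (x∈p─q⁻ p q x∈)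

∣p∣≡∣p∩q∣+∣p─q∣ : ∀ {n} (p q : Subset n) → ∣ p ∣ ≡ ∣ p ∩ q ∣ + ∣ p ─ q ∣
∣p∣≡∣p∩q∣+∣p─q∣ []            []            = refl
∣p∣≡∣p∩q∣+∣p─q∣ (outside ∷ p) (inside ∷ q)  = ∣p∣≡∣p∩q∣+∣p─q∣ p q
∣p∣≡∣p∩q∣+∣p─q∣ (outside ∷ p) (outside ∷ q) = ∣p∣≡∣p∩q∣+∣p─q∣ p q
∣p∣≡∣p∩q∣+∣p─q∣ (inside ∷ p)  (inside ∷ q)  = cong suc (∣p∣≡∣p∩q∣+∣p─q∣ p q)
∣p∣≡∣p∩q∣+∣p─q∣ (inside ∷ p)  (outside ∷ q) = trans (cong suc (∣p∣≡∣p∩q∣+∣p─q∣ p q)) (sym (+-suc _ _))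

disjoint⇒∣p∪q∣≡∣p∣+∣q∣ : ∀ {n} (p q : Subset n) → Disjoint p q → ∣ p ∪ q ∣ ≡ ∣ p ∣ + ∣ q ∣
disjoint⇒∣p∪q∣≡∣p∣+∣q∣ []            []            p#q = refl
disjoint⇒∣p∪q∣≡∣p∣+∣q∣ (inside ∷ p)  (inside ∷ q)  p#q = ⊥-elim (p#q here here)
disjoint⇒∣p∪q∣≡∣p∣+∣q∣ (inside ∷ p)  (outside ∷ q) p#q =
  cong suc (disjoint⇒∣p∪q∣≡∣p∣+∣q∣ p q (λ x∈p x∈q → p#q (there x∈p) (there x∈q)))
disjoint⇒∣p∪q∣≡∣p∣+∣q∣ (outside ∷ p) (inside ∷ q)  p#q =
  trans (cong suc (disjoint⇒∣p∪q∣≡∣p∣+∣q∣ p q (λ x∈p x∈q → p#q (there x∈p) (there x∈q)))) (sym (+-suc _ _))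
disjoint⇒∣p∪q∣≡∣p∣+∣q∣ (outside ∷ p) (outside ∷ q) p#q =
  disjoint⇒∣p∪q∣≡∣p∣+∣q∣ p q (λ x∈p x∈q → p#q (there x∈p) (there x∈q))

disjoint⇒∣p∣+∣q∣≤∣r∣ : ∀ {n} {p q r : Subset n} → Disjoint p q → p ⊆ r → q ⊆ r → ∣ p ∣ + ∣ q ∣ ≤ ∣ r ∣
disjoint⇒∣p∣+∣q∣≤∣r∣ {p = p} {q} p#q p⊆r q⊆r =
  subst (_≤ _) (disjoint⇒∣p∪q∣≡∣p∣+∣q∣ p q p#q) (p⊆q⇒∣p∣≤∣q∣ p∪q⊆r)
  where
  p∪q⊆r : p ∪ q ⊆ _
  p∪q⊆r x∈p∪q with x∈p∪q⁻ p q x∈p∪q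
  ... | inj₁ x∈p = p⊆r x∈p
  ... | inj₂ x∈q = q⊆r x∈q

∣p∣≤1+∣p-x∣ : ∀ {n} (p : Subset n) x → ∣ p ∣ ≤ suc ∣ p - x ∣
∣p∣≤1+∣p-x∣ p x = begin
  ∣ p ∣                       ≡⟨ ∣p∣≡∣p∩q∣+∣p─q∣ p ⁅ x ⁆ ⟩
  ∣ p ∩ ⁅ x ⁆ ∣ + ∣ p - x ∣  ≤⟨ +-monoˡ-≤ _ (subst (∣ p ∩ ⁅ x ⁆ ∣ ≤_) (∣⁅x⁆∣≡1 x) (∣p∩q∣≤∣q∣ p ⁅ x ⁆)) ⟩
  suc ∣ p - x ∣               ∎
  where open ≤-Reasoning

empty⇒∣p∣≡0 : ∀ {n} {p : Subset n} → Empty p → ∣ p ∣ ≡ 0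
empty⇒∣p∣≡0 {n} p-empty = trans (cong ∣_∣ (Empty-unique p-empty)) (∣⊥∣≡0 n)

x∈p⇒0<∣p∣ : ∀ {n} {p : Subset n} {x} → x ∈ p → 0 < ∣ p ∣
x∈p⇒0<∣p∣ x∈p = ≤-trans (s≤s z≤n) (x∈p⇒∣p-x∣<∣p∣ x∈p)

x∈image⁻ : ∀ {n k} (F : SetMap n k) W {y} → y ∈ image F W → ∃ λ x → x ∈ W × y ∈ F x
x∈image⁻ {zero}  F []           y∈ = ⊥-elim (∉⊥ y∈)
x∈image⁻ {suc n} F (inside ∷ W) y∈ with x∈p∪q⁻ (F zero) _ y∈
... | inj₁ y∈F0 = zero , here , y∈F0
... | inj₂ y∈FW = Product.map suc (Product.map₁ there) (x∈image⁻ (F ∘ suc) W y∈FW)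
x∈image⁻ {suc n} F (outside ∷ W) y∈ = Product.map suc (Product.map₁ there) (x∈image⁻ (F ∘ suc) W y∈)

x∈image⁺ : ∀ {n k} (F : SetMap n k) {W x y} → x ∈ W → y ∈ F x → y ∈ image F W
x∈image⁺ F {inside ∷ W}  here       y∈Fx = x∈p∪q⁺ (inj₁ y∈Fx)
x∈image⁺ F {inside ∷ W}  (there x∈) y∈Fx = x∈p∪q⁺ (inj₂ (x∈image⁺ (F ∘ suc) x∈ y∈Fx))
x∈image⁺ F {outside ∷ W} (there x∈) y∈Fx = x∈image⁺ (F ∘ suc) x∈ y∈Fx

image-mono : ∀ {n k} {F G : SetMap n k} {V W} → (∀ x → F x ⊆ G x) → V ⊆ W → image F V ⊆ image G W
image-mono {F = F} {G} {V} F⊆G V⊆W y∈FV with x∈image⁻ F V y∈FV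
... | x , x∈V , y∈Fx = x∈image⁺ G (V⊆W x∈V) (F⊆G x y∈Fx)

restrictMap-⊆ : ∀ {n k} {F : SetMap n k} {U} x → restrictMap F U x ⊆ F x
restrictMap-⊆ {F = F} {U} x = p─q⊆p (F x) (image F U)

restrictMap-antitone : ∀ {n k} {F : SetMap n k} {U U′} → U ⊆ U′ → ∀ x → restrictMap F U′ x ⊆ restrictMap F U x
restrictMap-antitone {F = F} {U} {U′} U⊆U′ x y∈ with x∈p─q⁻ (F x) (image F U′) y∈
... | y∈Fx , y∉FU′ = x∈p∧x∉q⇒x∈p─q y∈Fx (y∉FU′ ∘ image-mono (λ _ → id) U⊆U′)

∣image-restrictMap∣≤∣image∣ : ∀ {n k} (F : SetMap n k) U A → ∣ image (restrictMap F U) A ∣ ≤ ∣ image F A ∣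
∣image-restrictMap∣≤∣image∣ F U A = p⊆q⇒∣p∣≤∣q∣ (image-mono {F = restrictMap F U} restrictMap-⊆ id)

image-disjoint-restrictMap : ∀ {n k} (F : SetMap n k) {A U} B → A ⊆ U
                           → Disjoint (image F A) (image (restrictMap F U) B)
image-disjoint-restrictMap F {A} {U} B A⊆U y∈FA y∈GB with x∈image⁻ (restrictMap F U) B y∈GB
... | x , _ , y∈Gx = proj₂ (x∈p─q⁻ (F x) (image F U) y∈Gx) (image-mono (λ _ → id) A⊆U y∈FA)

module _ {n k} {G : SetMap n k} {S : Subset n} (S-nonReducible : NonReducible G S) where

  nonReducible⇒≤⇒< : ∀ {A} → A ⊂ S → Nonempty A → ∣ A ∣ ≤ ∣ image G A ∣ → ∣ A ∣ < ∣ image G A ∣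
  nonReducible⇒≤⇒< A⊂S A-nonempty A≤GA =
    ≤∧≢⇒< A≤GA (λ eq → proj₂ S-nonReducible _ A⊂S (A-nonempty , sym eq))

  nonReducible⇒hall : (∀ x → x ∈ S → Nonempty (G x)) → ∀ A → A ⊆ S → ∣ A ∣ ≤ ∣ image G A ∣
  nonReducible⇒hall G-nonempty A = go A (<-wellFounded ∣ A ∣)
    where
    go : ∀ A → Acc _<_ ∣ A ∣ → A ⊆ S → ∣ A ∣ ≤ ∣ image G A ∣
    go A (acc smaller) A⊆S with nonempty? A
    ... | no A-empty = ≤-trans (≤-reflexive (empty⇒∣p∣≡0 A-empty)) z≤n
    ... | yes (x , x∈A) = ≤-trans (∣p∣≤1+∣p-x∣ A x) 1+∣A-x∣≤∣GA∣
      where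
      ∣G[A-x]∣≤∣GA∣ : ∣ image G (A - x) ∣ ≤ ∣ image G A ∣
      ∣G[A-x]∣≤∣GA∣ = p⊆q⇒∣p∣≤∣q∣ (image-mono (λ _ → id) (proj₁ (x∈p⇒p-x⊂p x∈A)))
      1+∣A-x∣≤∣GA∣ : suc ∣ A - x ∣ ≤ ∣ image G A ∣
      1+∣A-x∣≤∣GA∣ with nonempty? (A - x)
      ... | no A-x-empty rewrite empty⇒∣p∣≡0 A-x-empty =
        x∈p⇒0<∣p∣ (x∈image⁺ G x∈A (proj₂ (G-nonempty x (A⊆S x∈A))))
      ... | yes A-x-nonempty = <-≤-trans
        (nonReducible⇒≤⇒< A-x⊂S A-x-nonempty (go (A - x) (smaller (x∈p⇒∣p-x∣<∣p∣ x∈A)) (proj₁ A-x⊂S)))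
        ∣G[A-x]∣≤∣GA∣
        where
        A-x⊂S : A - x ⊂ S
        A-x⊂S = ⊂-⊆-trans (x∈p⇒p-x⊂p x∈A) A⊆S

x∈unionBelow⁻ : ∀ {m n} (W : Fin m → Subset n) c {x} → x ∈ unionBelow W c → ∃ λ j → toℕ j < c × x ∈ W j
x∈unionBelow⁻ {zero}  W c       x∈ = ⊥-elim (∉⊥ x∈)
x∈unionBelow⁻ {suc m} W zero    x∈ = ⊥-elim (∉⊥ x∈)
x∈unionBelow⁻ {suc m} W (suc c) x∈ with x∈p∪q⁻ (W zero) _ x∈
... | inj₁ x∈W0   = zero , s≤s z≤n , x∈W0
... | inj₂ x∈rest = Product.map suc (Product.map₁ s≤s) (x∈unionBelow⁻ (W ∘ suc) c x∈rest)

x∈unionBelow⁺ : ∀ {m n} (W : Fin m → Subset n) {c} j {x} → toℕ j < c → x ∈ W j → x ∈ unionBelow W c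
x∈unionBelow⁺ W {suc c} zero    j<c       x∈Wj = x∈p∪q⁺ (inj₁ x∈Wj)
x∈unionBelow⁺ W {suc c} (suc j) (s≤s j<c) x∈Wj = x∈p∪q⁺ (inj₂ (x∈unionBelow⁺ (W ∘ suc) j j<c x∈Wj))

module HallPartitionProperties {n k} {F : SetMap n k} {m} {Ws : Fin m → Subset n}
                               (hp : HallPartition F m Ws) where
  open HallPartition hp

  U : ℕ → Subset n
  U = unionBelow Ws

  -- G (toℕ i) is hallG F Ws i, the paper's G_{i+1}.
  G : ℕ → SetMap n k
  G c = restrictMap F (U c)

  U-step : ∀ c → U c ⊆ U (suc c)
  U-step c x∈ with x∈unionBelow⁻ Ws c x∈
  ... | j , j<c , x∈Wj = x∈unionBelow⁺ Ws j (m≤n⇒m≤1+n j<c) x∈Wj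

  part⊆U : ∀ i → Ws i ⊆ U (suc (toℕ i))
  part⊆U i = x∈unionBelow⁺ Ws i (s≤s (≤-reflexive refl))

  ∉U-step : ∀ i {x} → x ∉ U (toℕ i) → x ∉ Ws i → x ∉ U (suc (toℕ i))
  ∉U-step i {x} x∉Ui x∉Wi x∈ with x∈unionBelow⁻ Ws (suc (toℕ i)) x∈
  ... | j , s≤s j≤i , x∈Wj with m≤n⇒m<n∨m≡n j≤i
  ...   | inj₁ j<i = x∉Ui (x∈unionBelow⁺ Ws j j<i x∈Wj)
  ...   | inj₂ j≡i = x∉Wi (subst (λ j → x ∈ Ws j) (toℕ-injective j≡i) x∈Wj)

  ∉U-zero : ∀ {x} → x ∉ U 0
  ∉U-zero x∈ with x∈unionBelow⁻ Ws 0 x∈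
  ... | _ , () , _

  ∈U-all : ∀ x → x ∈ U m
  ∈U-all x = subst (x ∈_) (sym covers) ∈⊤

  ─part-disjoint : ∀ i {V} → Disjoint V (U (toℕ i)) → Disjoint (V ─ Ws i) (U (suc (toℕ i)))
  ─part-disjoint i {V} V#U x∈ with x∈p─q⁻ V (Ws i) x∈
  ... | x∈V , x∉Wi = ∉U-step i (V#U x∈V) x∉Wi

  part-hall : ∀ i A → A ⊆ Ws i → ∣ A ∣ ≤ ∣ image (G (toℕ i)) A ∣
  part-hall i = nonReducible⇒hall (nonReducible i) (nonemptyVal i)

  image-split : ∀ i (H : SetMap n k) → (∀ x → H x ⊆ F x) → (∀ x → G (suc (toℕ i)) x ⊆ H x) → ∀ V
              → ∣ image H (V ∩ Ws i) ∣ + ∣ image (G (suc (toℕ i))) (V ─ Ws i) ∣ ≤ ∣ image H V ∣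
  image-split i H H⊆F G⊆H V = disjoint⇒∣p∣+∣q∣≤∣r∣
    (image-disjoint-restrictMap F (V ─ Ws i) (part⊆U i ∘ p∩q⊆q V (Ws i)) ∘ image-mono H⊆F id)
    (image-mono (λ _ → id) (p∩q⊆p V (Ws i)))
    (image-mono G⊆H (p─q⊆p V (Ws i)))

  HallBeyond : ℕ → Set
  HallBeyond c = ∀ V → Disjoint V (U c) → ∣ V ∣ ≤ ∣ image (G c) V ∣

  hallBeyond : ∀ (j : Fin (suc m)) → HallBeyond (toℕ j)
  hallBeyond = downwardInduction m HallBeyond hallBeyondAll hallBeyondPart
    where
    hallBeyondAll : HallBeyond m
    hallBeyondAll V V#U = ≤-trans (≤-reflexive (empty⇒∣p∣≡0 λ { (x , x∈V) → V#U x∈V (∈U-all x) })) z≤n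

    hallBeyondPart : ∀ i → HallBeyond (suc (toℕ i)) → HallBeyond (toℕ i)
    hallBeyondPart i hallBeyondNext V V#U = begin
      ∣ V ∣                                                      ≡⟨ ∣p∣≡∣p∩q∣+∣p─q∣ V (Ws i) ⟩
      ∣ V ∩ Ws i ∣ + ∣ V ─ Ws i ∣                                ≤⟨ +-mono-≤ (part-hall i _ (p∩q⊆q V (Ws i)))
                                                                      (hallBeyondNext _ (─part-disjoint i V#U)) ⟩
      ∣ image (G t) (V ∩ Ws i) ∣ + ∣ image (G (suc t)) (V ─ Ws i) ∣ ≤⟨ image-split i (G t) restrictMap-⊆
                                                                      (restrictMap-antitone (U-step t)) V ⟩
      ∣ image (G t) V ∣                                          ∎
      where
      t = toℕ i
      open ≤-Reasoning

  module _ {W : Subset n} (W-critical : Critical F W) (W-nonReducible : NonReducible F W) where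

    ¬∣W∣<∣FW∣ : ¬ ∣ W ∣ < ∣ image F W ∣
    ¬∣W∣<∣FW∣ = <-irrefl (sym (proj₂ W-critical))

    meets-part⇒⊆ : ∀ i → Disjoint W (U (toℕ i)) → Nonempty (W ∩ Ws i) → W ⊆ Ws i
    meets-part⇒⊆ i W#U W∩Wi-nonempty {x} x∈W with x ∈? Ws i
    ... | yes x∈Wi = x∈Wi
    ... | no  x∉Wi = ⊥-elim (¬∣W∣<∣FW∣ (begin-strict
      ∣ W ∣                                                   ≡⟨ ∣p∣≡∣p∩q∣+∣p─q∣ W (Ws i) ⟩
      ∣ W ∩ Ws i ∣ + ∣ W ─ Ws i ∣                             <⟨ +-mono-<-≤ ∣A∣<∣FA∣ (hallBeyond (suc i) _ (─part-disjoint i W#U)) ⟩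
      ∣ image F (W ∩ Ws i) ∣ + ∣ image (G (suc t)) (W ─ Ws i) ∣ ≤⟨ image-split i F (λ _ → id) restrictMap-⊆ W ⟩
      ∣ image F W ∣                                           ∎))
      where
      t = toℕ i
      A⊂W : W ∩ Ws i ⊂ W
      A⊂W = p∩q⊆p W (Ws i) , x , x∈W , x∉Wi ∘ p∩q⊆q W (Ws i)
      ∣A∣<∣FA∣ : ∣ W ∩ Ws i ∣ < ∣ image F (W ∩ Ws i) ∣
      ∣A∣<∣FA∣ = nonReducible⇒≤⇒< W-nonReducible A⊂W W∩Wi-nonempty
        (≤-trans (part-hall i _ (p∩q⊆q W (Ws i))) (∣image-restrictMap∣≤∣image∣ F _ _))
      open ≤-Reasoning

    ⊆part⇒≡ : ∀ i → W ⊆ Ws i → W ≡ Ws i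
    ⊆part⇒≡ i W⊆Wi = ⊆-antisym W⊆Wi Wi⊆W
      where
      Wi⊆W : Ws i ⊆ W
      Wi⊆W {x} x∈Wi with x ∈? W
      ... | yes x∈W = x∈W
      ... | no  x∉W = ⊥-elim (¬∣W∣<∣FW∣ (<-≤-trans
        (nonReducible⇒≤⇒< (nonReducible i) (W⊆Wi , x , x∈Wi , x∉W) (proj₁ W-critical) (part-hall i W W⊆Wi))
        (∣image-restrictMap∣≤∣image∣ F _ W)))

lemma6p4 : (n k : ℕ) → 0 < n → 0 < k → (F : SetMap n k)
    → (m : ℕ) → (Ws : Fin m → Subset n) → HallPartition F m Ws
    → (W : Subset n) → Critical F W → NonReducible F W
    → ∃ λ i → W ≡ Ws i
lemma6p4 _ _ _ _ F m Ws hp W W-critical W-nonReducible = firstPartMet zero (λ _ → ∉U-zero)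
  where
  open HallPartitionProperties hp

  PartMetBeyond : ℕ → Set
  PartMetBeyond c = Disjoint W (U c) → ∃ λ i → W ≡ Ws i

  firstPartMet : ∀ (j : Fin (suc m)) → PartMetBeyond (toℕ j)
  firstPartMet = downwardInduction m PartMetBeyond noPartLeft tryPart
    where
    noPartLeft : PartMetBeyond m
    noPartLeft W#U = ⊥-elim (W#U (proj₂ (proj₁ W-critical)) (∈U-all _))

    tryPart : ∀ i → PartMetBeyond (suc (toℕ i)) → PartMetBeyond (toℕ i)
    tryPart i skip W#U with nonempty? (W ∩ Ws i)
    ... | yes meets = i , ⊆part⇒≡ W-critical W-nonReducible i
                              (meets-part⇒⊆ W-critical W-nonReducible i W#U meets)
    ... | no  misses = skip λ x∈W → ∉U-step i (W#U x∈W) (λ x∈Wi → misses (_ , x∈p∩q⁺ (x∈W , x∈Wi)))
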